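{- Let $n\ge 3$ and $\pi_1,\pi_2\in S_n$. There is a clean isomorphism between $G^-_{\pi_1}$ and $G^-_{\pi_2}$ if, and only if, $\pi_1$ and $\pi_2$ are conjugate in $S_n$.
   Context: $S_n$ is the symmetric group on $\{1,\dots,n\}$. Fix disjoint vertex sets $A=\{a_1,\dots,a_n\}$, $B=\{b_1,\dots,b_n\}$, $C=\{c_1,\dots,c_n\}$, $D=\{d_1,\dots,d_n\}$. For $\pi\in S_n$, $G^-_\pi$ is the graph on $A\cup B\cup C\cup D$ with edge set consisting of: $\{a_i,b_j\}$ for all $i\ne j$; $\{b_i,c_i\}$ for all $i$; $\{c_i,d_j\}$ for all $i\neq j$; and $\{a_i,d_{\pi(i)}\}$ for all $i$. A map $\alpha$ from $A\cup B\cup C\cup D$ to itself is clean if $\alpha(A)=A$, $\alpha(B)=B$, $\alpha(C)=C$ and $\alpha(D)=D$. -}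

module Defs where

open import Data.Nat using (ℕ)
open import Data.Fin using (Fin)
open import Data.Fin.Permutation using (Permutation′; _⟨$⟩ʳ_; _⟨$⟩ˡ_)
open import Data.Product using (_×_; _,_; ∃; Σ)
open import Data.Sum using (_⊎_)
open import Data.Empty using (⊥)
open import Relation.Binary.PropositionalEquality using (_≡_; _≢_)
open import Function.Bundles using (_↔_; _⇔_; Inverse)

data Part : Set where
  A B C D : Part

-- Vertex (X , i) stands for x_{i} with x ∈ {a,b,c,d}; Fin n indexes {1,…,n}.
Vertex : ℕ → Set
Vertex n = Part × Fin n

-- Oriented listing of the edges of G⁻_π.
Edge : ∀ {n} → Permutation′ n → Vertex n → Vertex n → Set
Edge π (A , i) (B , j) = i ≢ j
Edge π (B , i) (C , j) = i ≡ j
Edge π (C , i) (D , j) = i ≢ j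
Edge π (A , i) (D , j) = π ⟨$⟩ʳ i ≡ j
Edge π _ _ = ⊥

Adj : ∀ {n} → Permutation′ n → Vertex n → Vertex n → Set
Adj π u v = Edge π u v ⊎ Edge π v u

PreservesPart : ∀ {n} → (Vertex n → Vertex n) → Part → Set
PreservesPart {n} α X =
  (∀ (i : Fin n) → ∃ λ j → α (X , i) ≡ (X , j)) ×
  (∀ (j : Fin n) → ∃ λ i → α (X , i) ≡ (X , j))

Clean : ∀ {n} → (Vertex n → Vertex n) → Set
Clean α = PreservesPart α A × PreservesPart α B × PreservesPart α C × PreservesPart α D

IsIso : ∀ {n} → Permutation′ n → Permutation′ n → (Vertex n ↔ Vertex n) → Set
IsIso π₁ π₂ α = ∀ u v → Adj π₁ u v ⇔ Adj π₂ (Inverse.to α u) (Inverse.to α v)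

CleanIso : ∀ {n} → Permutation′ n → Permutation′ n → Set
CleanIso {n} π₁ π₂ = Σ (Vertex n ↔ Vertex n) λ α → IsIso π₁ π₂ α × Clean (Inverse.to α)

Conjugate : ∀ {n} → Permutation′ n → Permutation′ n → Set
Conjugate {n} π₁ π₂ =
  ∃ λ (σ : Permutation′ n) → ∀ i → π₂ ⟨$⟩ʳ i ≡ σ ⟨$⟩ʳ (π₁ ⟨$⟩ʳ (σ ⟨$⟩ˡ i))

{-# OPTIONS --safe #-}
-- A clean isomorphism acts on each class X by a permutation σ_X of the indices.
-- Preserving the non-edges a_i b_i and c_i d_i forces σ_A = σ_B and σ_C = σ_D,
-- preserving the edges b_i c_i forces σ_B = σ_C, and preserving the edges a_i d_{π₁ i}
-- then says π₂ σ_A = σ_A π₁.  Conversely, if π₂ σ = σ π₁, relabelling every class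
-- by σ is a clean isomorphism.
module Submission where

open import Defs
open import Data.Nat using (ℕ; _≥_)
open import Data.Fin using (Fin)
open import Data.Fin.Properties using (_≟_)
open import Data.Fin.Permutation
  using (Permutation′; _⟨$⟩ʳ_; _⟨$⟩ˡ_; _≈_; permutation; flip; inverseˡ; inverseʳ)
open import Data.Product using (_,_; ∃; proj₁; proj₂)
open import Data.Product.Function.NonDependent.Propositional using (_×-↔_)
open import Data.Sum using ([_,_]; inj₁)
import Data.Sum as Sum
open import Function using (_∘_; id)
open import Function.Bundles using (_⇔_; _↔_; Inverse; Injection; Equivalence; mk⇔)
open import Function.Construct.Identity using (↔-id)
open import Function.Properties.Inverse using (↔⇒↣)
open import Relation.Nullary.Decidable using (decidable-stable)
open import Relation.Binary.PropositionalEquality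
  using (_≡_; _≢_; refl; sym; trans; cong; subst₂; module ≡-Reasoning)

private
  variable
    n : ℕ
    π₁ π₂ : Permutation′ n

record Intertwines (σ π₁ π₂ : Permutation′ n) : Set where
  constructor intertwines
  field
    commute : ∀ i → π₂ ⟨$⟩ʳ (σ ⟨$⟩ʳ i) ≡ σ ⟨$⟩ʳ (π₁ ⟨$⟩ʳ i)

intertwines⇒conjugate : (σ : Permutation′ n) → Intertwines σ π₁ π₂ → Conjugate π₁ π₂
intertwines⇒conjugate {π₁ = π₁} {π₂ = π₂} σ (intertwines commute) = σ , λ i → begin
  π₂ ⟨$⟩ʳ i                    ≡⟨ cong (π₂ ⟨$⟩ʳ_) (inverseʳ σ) ⟨
  π₂ ⟨$⟩ʳ (σ ⟨$⟩ʳ (σ ⟨$⟩ˡ i))   ≡⟨ commute (σ ⟨$⟩ˡ i) ⟩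
  σ ⟨$⟩ʳ (π₁ ⟨$⟩ʳ (σ ⟨$⟩ˡ i))   ∎
  where open ≡-Reasoning

conjugate⇒intertwines : ((σ , _) : Conjugate π₁ π₂) → Intertwines σ π₁ π₂
conjugate⇒intertwines {π₁ = π₁} (σ , π₂≡σπ₁σ⁻¹) = intertwines λ i →
  trans (π₂≡σπ₁σ⁻¹ (σ ⟨$⟩ʳ i)) (cong (λ k → σ ⟨$⟩ʳ (π₁ ⟨$⟩ʳ k)) (inverseˡ σ))

intertwines-flip : (σ : Permutation′ n) → Intertwines σ π₁ π₂ → Intertwines (flip σ) π₂ π₁
intertwines-flip {π₁ = π₁} {π₂ = π₂} σ (intertwines commute) = intertwines λ i → begin
  π₁ ⟨$⟩ʳ (σ ⟨$⟩ˡ i)                   ≡⟨ inverseˡ σ ⟨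
  σ ⟨$⟩ˡ (σ ⟨$⟩ʳ (π₁ ⟨$⟩ʳ (σ ⟨$⟩ˡ i)))  ≡⟨ cong (σ ⟨$⟩ˡ_) (commute (σ ⟨$⟩ˡ i)) ⟨
  σ ⟨$⟩ˡ (π₂ ⟨$⟩ʳ (σ ⟨$⟩ʳ (σ ⟨$⟩ˡ i)))  ≡⟨ cong (λ k → σ ⟨$⟩ˡ (π₂ ⟨$⟩ʳ k)) (inverseʳ σ) ⟩
  σ ⟨$⟩ˡ (π₂ ⟨$⟩ʳ i)                   ∎
  where open ≡-Reasoning

module _ (π : Permutation′ n) {i j : Fin n} where
  adj-AB : Adj π (A , i) (B , j) ⇔ (i ≢ j)
  adj-AB = mk⇔ [ id , (λ ()) ] inj₁

  adj-BC : Adj π (B , i) (C , j) ⇔ (i ≡ j)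
  adj-BC = mk⇔ [ id , (λ ()) ] inj₁

  adj-CD : Adj π (C , i) (D , j) ⇔ (i ≢ j)
  adj-CD = mk⇔ [ id , (λ ()) ] inj₁

  adj-AD : Adj π (A , i) (D , j) ⇔ (π ⟨$⟩ʳ i ≡ j)
  adj-AD = mk⇔ [ id , (λ ()) ] inj₁

relabel : Permutation′ n → Vertex n ↔ Vertex n
relabel σ = ↔-id Part ×-↔ σ

relabel-clean : (σ : Permutation′ n) → Clean (Inverse.to (relabel σ))
relabel-clean σ = preserves A , preserves B , preserves C , preserves D
  where
  preserves : ∀ X → PreservesPart (Inverse.to (relabel σ)) X
  preserves X = (λ i → σ ⟨$⟩ʳ i , refl) , (λ j → σ ⟨$⟩ˡ j , cong (X ,_) (inverseʳ σ))

module _ (σ : Permutation′ n) (σ-intertwines : Intertwines σ π₁ π₂) where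
  open Intertwines σ-intertwines

  relabel-edge : ∀ u v → Edge π₁ u v → Edge π₂ (Inverse.to (relabel σ) u) (Inverse.to (relabel σ) v)
  relabel-edge (A , i) (B , j) i≢j   = i≢j ∘ Injection.injective (↔⇒↣ σ)
  relabel-edge (B , i) (C , j) i≡j   = cong (σ ⟨$⟩ʳ_) i≡j
  relabel-edge (C , i) (D , j) i≢j   = i≢j ∘ Injection.injective (↔⇒↣ σ)
  relabel-edge (A , i) (D , j) π₁i≡j = trans (commute i) (cong (σ ⟨$⟩ʳ_) π₁i≡j)
  relabel-edge (A , _) (A , _) ()
  relabel-edge (A , _) (C , _) ()
  relabel-edge (B , _) (A , _) ()
  relabel-edge (B , _) (B , _) ()
  relabel-edge (B , _) (D , _) ()
  relabel-edge (C , _) (A , _) ()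
  relabel-edge (C , _) (B , _) ()
  relabel-edge (C , _) (C , _) ()
  relabel-edge (D , _) (_ , _) ()

  relabel-adj : ∀ u v → Adj π₁ u v → Adj π₂ (Inverse.to (relabel σ) u) (Inverse.to (relabel σ) v)
  relabel-adj u v = Sum.map (relabel-edge u v) (relabel-edge v u)

relabel-isIso : (σ : Permutation′ n) → Intertwines σ π₁ π₂ → IsIso π₁ π₂ (relabel σ)
relabel-isIso {π₁ = π₁} σ σ-intertwines u v = mk⇔
  (relabel-adj σ σ-intertwines u v)
  (subst₂ (Adj π₁) (back u) (back v) ∘ relabel-adj (flip σ) (intertwines-flip σ σ-intertwines) _ _)
  where
  back : ∀ w → Inverse.to (relabel (flip σ)) (Inverse.to (relabel σ) w) ≡ w
  back = Inverse.strictlyInverseʳ (relabel σ)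

intertwines⇒cleanIso : (σ : Permutation′ n) → Intertwines σ π₁ π₂ → CleanIso π₁ π₂
intertwines⇒cleanIso σ σ-intertwines = relabel σ , relabel-isIso σ σ-intertwines , relabel-clean σ

partPermutation : (α : Vertex n ↔ Vertex n) {X : Part} → PreservesPart (Inverse.to α) X → Permutation′ n
partPermutation α (forth , back) = permutation (proj₁ ∘ forth) (proj₁ ∘ back) inverseₗ inverseᵣ
  where
  inverseₗ : ∀ j → proj₁ (forth (proj₁ (back j))) ≡ j
  inverseₗ j = cong proj₂ (trans (sym (proj₂ (forth (proj₁ (back j))))) (proj₂ (back j)))

  inverseᵣ : ∀ i → proj₁ (back (proj₁ (forth i))) ≡ i
  inverseᵣ i = cong proj₂ (Injection.injective (↔⇒↣ α)
                             (trans (proj₂ (back (proj₁ (forth i)))) (sym (proj₂ (forth i)))))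

ActsOnParts : (Vertex n → Vertex n) → (Part → Permutation′ n) → Set
ActsOnParts f σ = ∀ X i → f (X , i) ≡ (X , σ X ⟨$⟩ʳ i)

clean⇒actsOnParts : (α : Vertex n ↔ Vertex n) → Clean (Inverse.to α) → ∃ (ActsOnParts (Inverse.to α))
clean⇒actsOnParts {n} α (pA , pB , pC , pD) = σ , λ X i → proj₂ (proj₁ (preserves X) i)
  where
  preserves : ∀ X → PreservesPart (Inverse.to α) X
  preserves A = pA
  preserves B = pB
  preserves C = pC
  preserves D = pD

  σ : Part → Permutation′ n
  σ X = partPermutation α (preserves X)

module _ (α : Vertex n ↔ Vertex n) (iso : IsIso π₁ π₂ α)
         (σ : Part → Permutation′ n) (acts : ActsOnParts (Inverse.to α) σ) where

  adj-transport : ∀ X Y {i j} → Adj π₁ (X , i) (Y , j) ⇔ Adj π₂ (X , σ X ⟨$⟩ʳ i) (Y , σ Y ⟨$⟩ʳ j)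
  adj-transport X Y {i} {j} =
    subst₂ (λ u v → Adj π₁ (X , i) (Y , j) ⇔ Adj π₂ u v) (acts X i) (acts Y j) (iso (X , i) (Y , j))

  transport-matching : ∀ X Y (f : Permutation′ n → Fin n → Fin n) →
                       (∀ π {i j} → Adj π (X , i) (Y , j) ⇔ (f π i ≡ j)) →
                       ∀ i → f π₂ (σ X ⟨$⟩ʳ i) ≡ σ Y ⟨$⟩ʳ (f π₁ i)
  transport-matching X Y f adj⇔graph i =
    Equivalence.to (adj⇔graph π₂) (Equivalence.to (adj-transport X Y) (Equivalence.from (adj⇔graph π₁) refl))

  agree-on-antimatching : ∀ X Y → (∀ π {i j} → Adj π (X , i) (Y , j) ⇔ (i ≢ j)) → σ X ≈ σ Y
  agree-on-antimatching X Y adj⇔≢ i = decidable-stable (σ X ⟨$⟩ʳ i ≟ σ Y ⟨$⟩ʳ i) λ σXi≢σYi →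
    Equivalence.to (adj⇔≢ π₁) (Equivalence.from (adj-transport X Y) (Equivalence.from (adj⇔≢ π₂) σXi≢σYi)) refl

  σA≈σD : σ A ≈ σ D
  σA≈σD i = begin
    σ A ⟨$⟩ʳ i  ≡⟨ agree-on-antimatching A B adj-AB i ⟩
    σ B ⟨$⟩ʳ i  ≡⟨ transport-matching B C (λ _ → id) adj-BC i ⟩
    σ C ⟨$⟩ʳ i  ≡⟨ agree-on-antimatching C D adj-CD i ⟩
    σ D ⟨$⟩ʳ i  ∎
    where open ≡-Reasoning

  σA-intertwines : Intertwines (σ A) π₁ π₂
  σA-intertwines = intertwines λ i → begin
    π₂ ⟨$⟩ʳ (σ A ⟨$⟩ʳ i)  ≡⟨ transport-matching A D _⟨$⟩ʳ_ adj-AD i ⟩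
    σ D ⟨$⟩ʳ (π₁ ⟨$⟩ʳ i)  ≡⟨ σA≈σD (π₁ ⟨$⟩ʳ i) ⟨
    σ A ⟨$⟩ʳ (π₁ ⟨$⟩ʳ i)  ∎
    where open ≡-Reasoning

cleanIso⇒intertwines : CleanIso π₁ π₂ → ∃ λ σ → Intertwines σ π₁ π₂
cleanIso⇒intertwines (α , iso , clean) =
  let σ , acts = clean⇒actsOnParts α clean in σ A , σA-intertwines α iso σ acts

lemma14 : (n : ℕ) → n ≥ 3 → (π₁ π₂ : Permutation′ n) →
    CleanIso π₁ π₂ ⇔ Conjugate π₁ π₂
lemma14 n _ π₁ π₂ = mk⇔
  (λ cleanIso → let σ , σ-intertwines = cleanIso⇒intertwines cleanIso in
                intertwines⇒conjugate σ σ-intertwines)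
  (λ conjugate → intertwines⇒cleanIso (proj₁ conjugate) (conjugate⇒intertwines conjugate))
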